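{- Let $s,N$ be natural numbers with $s\le N$, and let $\phi:\mathbb{Z}_N^2\to\mathbb{Z}_N$ be $\phi(x,y)=r_1x+r_2y$ with $(r_1,r_2)\ne(0,0)$. Then $\mathbb{Z}_N$ can be partitioned into arithmetic progressions $P_1,\dots,P_M$, all with the same common difference, with $M\le8N^{4/3}/s^{2/3}$, such that the lengths of any two $P_j$ differ by at most $1$ and, for all $i,j\in\{1,\dots,M\}$, the diameter of $\phi(P_i\times P_j)$ is at most $s$.
   Context: The diameter of a set $X\subseteq\mathbb{Z}_N$ is $\max_{a,b\in X}\|a-b\|$, where for $z\in\mathbb{Z}_N$, $\|z\|$ denotes the least absolute value of an integer representative of $z$. -}

module Defs where

open import Data.Nat using (ℕ; zero; suc; _+_; _*_; _∸_; _≤_; _<_; NonZero; _⊓_)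
open import Data.Nat.DivMod using (_mod_)
open import Data.Fin using (Fin; toℕ)
open import Data.Product using (Σ; _×_)
open import Relation.Binary.PropositionalEquality using (_≡_)

-- ℤ_N is represented by Fin N (canonical representatives 0,…,N-1), N ≥ 1.

norm : (N : ℕ) .{{_ : NonZero N}} → Fin N → ℕ
norm N z = toℕ z ⊓ (N ∸ toℕ z)

subN : (N : ℕ) .{{_ : NonZero N}} → Fin N → Fin N → Fin N
subN N a b = (toℕ a + (N ∸ toℕ b)) mod N

distN : (N : ℕ) .{{_ : NonZero N}} → Fin N → Fin N → ℕ
distN N a b = norm N (subN N a b)

phi : (N : ℕ) .{{_ : NonZero N}} → Fin N → Fin N → Fin N → Fin N → Fin N
phi N r₁ r₂ x y = (toℕ r₁ * toℕ x + toℕ r₂ * toℕ y) mod N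

apTerm : (N : ℕ) .{{_ : NonZero N}} → Fin N → Fin N → ℕ → Fin N
apTerm N a d k = (toℕ a + k * toℕ d) mod N

-- The progressions P_i = {a i + k·d : k < L i}, i ∈ Fin M, (with common difference d)
-- partition ℤ_N: each part is nonempty, and every x ∈ ℤ_N is hit by exactly one
-- pair (i , k) with k < L i (so in particular P_i has exactly L i elements).
IsAPPartition : (N : ℕ) .{{_ : NonZero N}} (M : ℕ) → Fin N → (Fin M → Fin N) → (Fin M → ℕ) → Set
IsAPPartition N M d a L =
  ((i : Fin M) → 1 ≤ L i) ×
  ((x : Fin N) → Σ (Fin M) λ i → Σ ℕ λ k →
     k < L i × apTerm N (a i) d k ≡ x ×
     ((i' : Fin M) (k' : ℕ) → k' < L i' → apTerm N (a i') d k' ≡ x → i' ≡ i × k' ≡ k))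

DiamPhiLe : (N : ℕ) .{{_ : NonZero N}} (M : ℕ) → Fin N → Fin N → Fin N → (Fin M → Fin N) → (Fin M → ℕ)
            → Fin M → Fin M → ℕ → Set
DiamPhiLe N M r₁ r₂ d a L i j s =
  (k k' l l' : ℕ) → k < L i → k' < L i → l < L j → l' < L j →
  distN N (phi N r₁ r₂ (apTerm N (a i) d k) (apTerm N (a j) d l))
          (phi N r₁ r₂ (apTerm N (a i) d k') (apTerm N (a j) d l')) ≤ s

{-# OPTIONS --safe #-}
module Submission where

-- Put B = ⌈∛(N s)⌉ and b = ⌈N / B⌉. Two of the b² + 1 points k (r₁ , r₂), k ≤ b², fall into the same one of the
-- b² squares of side B in ℤ_N², so some d ≤ b² (or d = 0 when N ≤ b²) has r₁ d and r₂ d congruent to numbers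
-- of absolute value below B. Cut every coset of ⟨d⟩ into runs c, c + d, …, c + ℓ d of balanced lengths, with
-- ℓ = ⌊s / 2B⌋; on the product of two runs φ varies by at most ℓ (|r₁ d| + |r₂ d|) ≤ s. There are at most
-- N / (ℓ + 1) + gcd N d ≤ 2BN / s + 4N² / B² ≤ 8 N^{4/3} / s^{2/3} runs.

open import Defs
open import Data.Nat
  using (ℕ; zero; suc; _+_; _*_; _∸_; _^_; _≤_; _<_; _⊓_; _/_; _%_; z≤n; s≤s; s≤s⁻¹; _≟_; _<?_; _≤?_;
         NonZero; ≢-nonZero; ≢-nonZero⁻¹; >-nonZero; >-nonZero⁻¹)
open import Data.Nat.Properties
open import Data.Nat.DivMod
  using (_mod_; m≡m%n+[m/n]*n; m%n<n; m/n*n≤m; m≥n⇒m/n>0; m<n⇒m%n≡m; m<n*o⇒m/o<n; m*[n/m]≡n;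
         %-remove-+ʳ; %-distribˡ-+; m%n%n≡m%n; m∣n⇒o%n%m≡o%m)
open import Data.Nat.Divisibility using (_∣_; divides; >⇒∤; ∣n⇒∣m*n; *-cancelˡ-∣)
open import Data.Nat.GCD using (gcd; gcd[m,n]≢0; gcd[m,n]∣m; gcd[m,n]∣n; gcd[m,n]≤n; gcd-identityʳ; m/gcd[m,n]≢0)
open import Data.Nat.Coprimality using (coprime-/gcd; coprime-divisor)
open import Data.Nat.Tactic.RingSolver using (solve-∀)
open import Data.Fin using (Fin; toℕ; fromℕ<; remQuot; combine; punchOut)
import Data.Fin as Fin
open import Data.Fin.Properties
  using (toℕ-fromℕ<; toℕ<n; toℕ-injective; any?; punchOut-injective; injective⇒≤; pigeonhole;
         combine-injective; remQuot-combine; combine-remQuot)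
  renaming (_≟_ to _≟ᶠ_)
open import Data.Product using (Σ; _×_; _,_; proj₁; proj₂)
open import Data.Sum using (inj₁; inj₂)
open import Data.Empty using (⊥-elim)
open import Data.List using (_∷_; [])
open import Function.Base using (_∘_)
open import Function.Definitions using (Injective; Surjective)
open import Relation.Nullary using (¬_; yes; no)
open import Relation.Binary.Definitions using (tri<; tri≈; tri>)
open import Relation.Binary.PropositionalEquality
import Data.Integer as ℤ
import Data.Integer.Properties as ℤₚ
open ℤ using (ℤ; +_; -[1+_]; ∣_∣; _⊖_)
import Data.Integer.Divisibility.Signed as ℤ∣
open import Data.Integer.Tactic.RingSolver using () renaming (solve to ℤ-solve; solve-∀ to ℤ-solve-∀)

infix 4 _≡_[mod_]
record _≡_[mod_] (a b : ℤ) (N : ℕ) : Set where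
  constructor congruent
  field divides-difference : + N ℤ∣.∣ a ℤ.- b

module _ {N : ℕ} where

  private
    congruent-by : ∀ {x a b} → + N ℤ∣.∣ x → x ≡ a ℤ.- b → a ≡ b [mod N ]
    congruent-by p refl = congruent p

  ≡⇒≡[mod] : ∀ {a b} → a ≡ b → a ≡ b [mod N ]
  ≡⇒≡[mod] {a} refl = congruent (ℤ∣.divides (+ 0) (ℤ-solve (a ∷ [])))

  mod-sym : ∀ {a b} → a ≡ b [mod N ] → b ≡ a [mod N ]
  mod-sym {a} {b} (congruent p) = congruent-by (ℤ∣.∣m⇒∣-m p) (ℤ-solve (a ∷ b ∷ []))

  mod-trans : ∀ {a b c} → a ≡ b [mod N ] → b ≡ c [mod N ] → a ≡ c [mod N ]
  mod-trans {a} {b} {c} (congruent p) (congruent q) =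
    congruent-by (ℤ∣.∣m∣n⇒∣m+n p q) (ℤ-solve (a ∷ b ∷ c ∷ []))

  mod-+ : ∀ {a b c e} → a ≡ b [mod N ] → c ≡ e [mod N ] → a ℤ.+ c ≡ b ℤ.+ e [mod N ]
  mod-+ {a} {b} {c} {e} (congruent p) (congruent q) =
    congruent-by (ℤ∣.∣m∣n⇒∣m+n p q) (ℤ-solve (a ∷ b ∷ c ∷ e ∷ []))

  mod-- : ∀ {a b c e} → a ≡ b [mod N ] → c ≡ e [mod N ] → a ℤ.- c ≡ b ℤ.- e [mod N ]
  mod-- {a} {b} {c} {e} (congruent p) (congruent q) =
    congruent-by (ℤ∣.∣m∣n⇒∣m-n p q) (ℤ-solve (a ∷ b ∷ c ∷ e ∷ []))

  mod-*ˡ : ∀ k {a b} → a ≡ b [mod N ] → k ℤ.* a ≡ k ℤ.* b [mod N ]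
  mod-*ˡ k {a} {b} (congruent p) = congruent-by (ℤ∣.∣n⇒∣m*n k p) (ℤ-solve (k ∷ a ∷ b ∷ []))

%-≡[mod] : ∀ N .{{_ : NonZero N}} x → + (x % N) ≡ + x [mod N ]
%-≡[mod] N x = congruent (ℤ∣.divides (ℤ.- + (x / N)) (begin
  + (x % N) ℤ.- + x                              ≡⟨ cong (λ y → + (x % N) ℤ.- y) x≡r+qN ⟩
  + (x % N) ℤ.- (+ (x % N) ℤ.+ + (x / N) ℤ.* + N) ≡⟨ lemma (+ (x % N)) (+ (x / N)) (+ N) ⟩
  ℤ.- + (x / N) ℤ.* + N                          ∎))
  where
  open ≡-Reasoning
  x≡r+qN : + x ≡ + (x % N) ℤ.+ + (x / N) ℤ.* + N
  x≡r+qN = trans (cong +_ (m≡m%n+[m/n]*n x N))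
                 (trans (ℤₚ.pos-+ (x % N) _) (cong (ℤ._+_ (+ (x % N))) (ℤₚ.pos-* (x / N) N)))
  lemma : ∀ r q n → r ℤ.- (r ℤ.+ q ℤ.* n) ≡ ℤ.- q ℤ.* n
  lemma = ℤ-solve-∀

toℕ-mod-≡[mod] : ∀ N .{{_ : NonZero N}} x → + toℕ (x mod N) ≡ + x [mod N ]
toℕ-mod-≡[mod] N x rewrite toℕ-fromℕ< (m%n<n x N) = %-≡[mod] N x

w⊓[N∸w]≤∣w-qN∣ : ∀ {N w} q → w < N → w ⊓ (N ∸ w) ≤ ∣ + w ℤ.- q ℤ.* + N ∣
w⊓[N∸w]≤∣w-qN∣ {N} {w} (+ zero) _ = ≤-trans (m⊓n≤m w (N ∸ w)) (m≤m+n w 0)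
w⊓[N∸w]≤∣w-qN∣ {N} {w} (+ suc k) w<N = begin
  w ⊓ (N ∸ w)                  ≤⟨ m⊓n≤n w (N ∸ w) ⟩
  N ∸ w                        ≤⟨ ∸-monoˡ-≤ w (m≤m+n N (k * N)) ⟩
  suc k * N ∸ w                ≡⟨ cong ∣_∣ (ℤₚ.⊖-≥ w≤kN) ⟨
  ∣ suc k * N ⊖ w ∣            ≡⟨ ℤₚ.∣m⊖n∣≡∣n⊖m∣ (suc k * N) w ⟩
  ∣ w ⊖ suc k * N ∣            ≡⟨ cong ∣_∣ (ℤₚ.m-n≡m⊖n w (suc k * N)) ⟨
  ∣ + w ℤ.- + (suc k * N) ∣    ≡⟨ cong (λ y → ∣ + w ℤ.- y ∣) (ℤₚ.pos-* (suc k) N) ⟩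
  ∣ + w ℤ.- + suc k ℤ.* + N ∣  ∎
  where
  open ≤-Reasoning
  w≤kN : w ≤ suc k * N
  w≤kN = ≤-trans (<⇒≤ w<N) (m≤m+n N (k * N))
w⊓[N∸w]≤∣w-qN∣ {N} {w} -[1+ k ] _ = begin
  w ⊓ (N ∸ w)                     ≤⟨ m⊓n≤m w (N ∸ w) ⟩
  w                               ≤⟨ m≤m+n w (suc k * N) ⟩
  ∣ + (w + suc k * N) ∣           ≡⟨ cong ∣_∣ (trans (ℤₚ.pos-+ w _) (cong (ℤ._+_ (+ w)) (ℤₚ.pos-* (suc k) N))) ⟩
  ∣ + w ℤ.+ + suc k ℤ.* + N ∣     ≡⟨ cong ∣_∣ (lemma (+ w) (+ suc k) (+ N)) ⟩
  ∣ + w ℤ.- -[1+ k ] ℤ.* + N ∣    ∎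
  where
  open ≤-Reasoning
  lemma : ∀ w k n → w ℤ.+ k ℤ.* n ≡ w ℤ.- (ℤ.- k) ℤ.* n
  lemma = ℤ-solve-∀

norm-≤ : ∀ N .{{_ : NonZero N}} (w : Fin N) D → + toℕ w ≡ D [mod N ] → norm N w ≤ ∣ D ∣
norm-≤ N w D (congruent (ℤ∣.divides q w-D≡qN)) = subst (λ y → norm N w ≤ ∣ y ∣) (D≡w-qN (+ toℕ w) D _ w-D≡qN)
                                        (w⊓[N∸w]≤∣w-qN∣ q (toℕ<n w))
  where
  D≡w-qN : ∀ w D t → w ℤ.- D ≡ t → w ℤ.- t ≡ D
  D≡w-qN w D t refl = lemma w D
    where
    lemma : ∀ w D → w ℤ.- (w ℤ.- D) ≡ D
    lemma = ℤ-solve-∀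

distN-≤ : ∀ N .{{_ : NonZero N}} (x y : Fin N) D → + toℕ x ℤ.- + toℕ y ≡ D [mod N ] → distN N x y ≤ ∣ D ∣
distN-≤ N x y D x-y≡D = norm-≤ N (subN N x y) D (mod-trans (toℕ-mod-≡[mod] N _) (mod-trans x+N-y≡x-y x-y≡D))
  where
  x+N-y≡x-y : + (toℕ x + (N ∸ toℕ y)) ≡ + toℕ x ℤ.- + toℕ y [mod N ]
  x+N-y≡x-y = congruent (ℤ∣.divides (+ 1) (begin
    + (toℕ x + (N ∸ toℕ y)) ℤ.- (+ toℕ x ℤ.- + toℕ y)           ≡⟨ cong (ℤ._- (+ toℕ x ℤ.- + toℕ y)) (ℤₚ.pos-+ (toℕ x) _) ⟩
    (+ toℕ x ℤ.+ + (N ∸ toℕ y)) ℤ.- (+ toℕ x ℤ.- + toℕ y)       ≡⟨ cong (λ z → (+ toℕ x ℤ.+ z) ℤ.- (+ toℕ x ℤ.- + toℕ y)) N-y ⟨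
    (+ toℕ x ℤ.+ (+ N ℤ.- + toℕ y)) ℤ.- (+ toℕ x ℤ.- + toℕ y)  ≡⟨ lemma (+ toℕ x) (+ toℕ y) (+ N) ⟩
    + 1 ℤ.* + N                                                  ∎))
    where
    open ≡-Reasoning
    N-y : + N ℤ.- + toℕ y ≡ + (N ∸ toℕ y)
    N-y = trans (ℤₚ.m-n≡m⊖n N (toℕ y)) (ℤₚ.⊖-≥ (<⇒≤ (toℕ<n y)))
    lemma : ∀ x y n → (x ℤ.+ (n ℤ.- y)) ℤ.- (x ℤ.- y) ≡ + 1 ℤ.* n
    lemma = ℤ-solve-∀

∣k-k'∣≤ℓ : ∀ {k k' ℓ} → k ≤ ℓ → k' ≤ ℓ → ∣ + k ℤ.- + k' ∣ ≤ ℓ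
∣k-k'∣≤ℓ {k} {k'} k≤ℓ k'≤ℓ = subst (_≤ _) (cong ∣_∣ (sym (ℤₚ.m-n≡m⊖n k k'))) (≤-trans (ℤₚ.∣m⊝n∣≤m⊔n k k') (⊔-lub k≤ℓ k'≤ℓ))

[1+j]⊓r∸j⊓r≤1 : ∀ j r → suc j ⊓ r ∸ j ⊓ r ≤ 1
[1+j]⊓r∸j⊓r≤1 zero    zero    = z≤n
[1+j]⊓r∸j⊓r≤1 (suc j) zero    = z≤n
[1+j]⊓r∸j⊓r≤1 zero    (suc r) = s≤s z≤n
[1+j]⊓r∸j⊓r≤1 (suc j) (suc r) = [1+j]⊓r∸j⊓r≤1 j r

∣∧<⇒≡0 : ∀ {n δ} → n ∣ δ → δ < n → δ ≡ 0
∣∧<⇒≡0 {δ = zero}  _   _   = refl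
∣∧<⇒≡0 {δ = suc _} n∣δ δ<n = ⊥-elim (>⇒∤ δ<n n∣δ)

%-≡⇒∣∸ : ∀ N .{{_ : NonZero N}} {x y} → x % N ≡ y % N → N ∣ x ∸ y
%-≡⇒∣∸ N {x} {y} x%N≡y%N = divides (x / N ∸ y / N) (begin
  x ∸ y                                       ≡⟨ cong₂ _∸_ (m≡m%n+[m/n]*n x N) (m≡m%n+[m/n]*n y N) ⟩
  (x % N + x / N * N) ∸ (y % N + y / N * N)   ≡⟨ cong (λ z → (z + x / N * N) ∸ (y % N + y / N * N)) x%N≡y%N ⟩
  (y % N + x / N * N) ∸ (y % N + y / N * N)   ≡⟨ [m+n]∸[m+o]≡n∸o (y % N) _ _ ⟩
  x / N * N ∸ y / N * N                       ≡⟨ *-distribʳ-∸ N (x / N) (y / N) ⟨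
  (x / N ∸ y / N) * N                         ∎)
  where open ≡-Reasoning

injective⇒surjective : ∀ {m n} {f : Fin m → Fin n} → n ≤ m → Injective _≡_ _≡_ f → Surjective _≡_ _≡_ f
injective⇒surjective {m} {suc n} {f} n<m f-inj y with any? (λ x → f x ≟ᶠ y)
... | yes (x , fx≡y) = x , λ { refl → fx≡y }
... | no  y∉f        = ⊥-elim (<⇒≱ n<m (injective⇒≤ {f = f′} f′-injective))
  where
  y≢f : ∀ x → y ≢ f x
  y≢f x y≡fx = y∉f (x , sym y≡fx)
  f′ : Fin m → Fin n
  f′ x = punchOut (y≢f x)
  f′-injective : Injective _≡_ _≡_ f′
  f′-injective eq = f-inj (punchOut-injective (y≢f _) (y≢f _) eq)

%-absorbˡ-+ : ∀ N .{{_ : NonZero N}} x y → (x % N + y) % N ≡ (x + y) % N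
%-absorbˡ-+ N x y = begin
  (x % N + y) % N          ≡⟨ %-distribˡ-+ (x % N) y N ⟩
  (x % N % N + y % N) % N  ≡⟨ cong (λ z → (z + y % N) % N) (m%n%n≡m%n x N) ⟩
  (x % N + y % N) % N      ≡⟨ %-distribˡ-+ x y N ⟨
  (x + y) % N              ∎
  where open ≡-Reasoning

n≤[n+ℓ]/[1+ℓ]*[1+ℓ] : ∀ n ℓ → n ≤ (n + ℓ) / suc ℓ * suc ℓ
n≤[n+ℓ]/[1+ℓ]*[1+ℓ] n ℓ = +-cancelʳ-≤ ℓ n _ (begin
  n + ℓ                                         ≡⟨ m≡m%n+[m/n]*n (n + ℓ) (suc ℓ) ⟩
  (n + ℓ) % suc ℓ + (n + ℓ) / suc ℓ * suc ℓ     ≤⟨ +-monoˡ-≤ _ (s≤s⁻¹ (m%n<n (n + ℓ) (suc ℓ))) ⟩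
  ℓ + (n + ℓ) / suc ℓ * suc ℓ                   ≡⟨ +-comm ℓ _ ⟩
  (n + ℓ) / suc ℓ * suc ℓ + ℓ                   ∎)
  where open ≤-Reasoning

[n+ℓ]/[1+ℓ]≤n : ∀ n .{{_ : NonZero n}} ℓ → (n + ℓ) / suc ℓ ≤ n
[n+ℓ]/[1+ℓ]≤n n ℓ = *-cancelʳ-≤ _ n (suc ℓ) (begin
  (n + ℓ) / suc ℓ * suc ℓ  ≤⟨ m/n*n≤m (n + ℓ) (suc ℓ) ⟩
  n + ℓ                    ≤⟨ +-monoʳ-≤ n (m≤n*m ℓ n) ⟩
  n + n * ℓ                ≡⟨ *-suc n ℓ ⟨
  n * suc ℓ                ∎)
  where open ≤-Reasoning

m≤n*[1+m/n] : ∀ m n .{{_ : NonZero n}} → m ≤ n * suc (m / n)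
m≤n*[1+m/n] m n = begin
  m                      ≡⟨ m≡m%n+[m/n]*n m n ⟩
  m % n + m / n * n      ≤⟨ +-monoˡ-≤ (m / n * n) (<⇒≤ (m%n<n m n)) ⟩
  n + m / n * n          ≡⟨ cong (_+_ n) (*-comm (m / n) n) ⟩
  n + n * (m / n)        ≡⟨ *-suc n (m / n) ⟨
  n * suc (m / n)        ∎
  where open ≤-Reasoning

-- {0, …, n-1} cut into m consecutive blocks [lower j , lower j + size j); the first n % m of them get one extra element.
module Blocks (n m : ℕ) .{{_ : NonZero m}} where

  q r : ℕ
  q = n / m
  r = n % m

  lower size : ℕ → ℕ
  lower j = j * q + j ⊓ r
  size j = q + (suc j ⊓ r ∸ j ⊓ r)

  lower-suc : ∀ j → lower (suc j) ≡ lower j + size j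
  lower-suc j = begin
    (q + j * q) + suc j ⊓ r                      ≡⟨ cong (_+_ (q + j * q)) (m+[n∸m]≡n (⊓-monoˡ-≤ r (n≤1+n j))) ⟨
    (q + j * q) + (j ⊓ r + (suc j ⊓ r ∸ j ⊓ r))  ≡⟨ lemma (j * q) q (j ⊓ r) (suc j ⊓ r ∸ j ⊓ r) ⟩
    j * q + j ⊓ r + (q + (suc j ⊓ r ∸ j ⊓ r))    ∎
    where
    open ≡-Reasoning
    lemma : ∀ jq q a x → (q + jq) + (a + x) ≡ jq + a + (q + x)
    lemma = solve-∀

  lower-mono : ∀ {j j'} → j ≤ j' → lower j ≤ lower j'
  lower-mono j≤j' = +-mono-≤ (*-monoˡ-≤ q j≤j') (⊓-monoˡ-≤ r j≤j')

  lower-m : lower m ≡ n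
  lower-m = begin
    m * q + m ⊓ r  ≡⟨ cong (_+_ (m * q)) (m≥n⇒m⊓n≡n (<⇒≤ (m%n<n n m))) ⟩
    m * q + r      ≡⟨ trans (+-comm (m * q) r) (cong (_+_ r) (*-comm m q)) ⟩
    r + q * m      ≡⟨ m≡m%n+[m/n]*n n m ⟨
    n              ∎
    where open ≡-Reasoning

  size-≤-suc : ∀ j → size j ≤ suc q
  size-≤-suc j = ≤-trans (+-monoʳ-≤ q ([1+j]⊓r∸j⊓r≤1 j r)) (≤-reflexive (+-comm q 1))

  size-balanced : ∀ i j → size i ≤ size j + 1
  size-balanced i j = ≤-trans (size-≤-suc i) (≤-trans (≤-reflexive (+-comm 1 q)) (+-monoˡ-≤ 1 (m≤m+n q _)))

  size-≥1 : m ≤ n → ∀ j → 1 ≤ size j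
  size-≥1 m≤n j = ≤-trans (m≥n⇒m/n>0 m≤n) (m≤m+n q _)

  size-≤ : ∀ {ℓ} → n ≤ m * ℓ → ∀ j → size j ≤ ℓ
  size-≤ {ℓ} n≤mℓ j with r ≟ 0
  ... | yes r≡0 = subst (_≤ ℓ) size≡q (*-cancelʳ-≤ q ℓ m (≤-trans qm≤n (≤-trans n≤mℓ (≤-reflexive (*-comm m ℓ)))))
    where
    size≡q : q ≡ size j
    size≡q = sym (trans (cong (λ t → q + (suc j ⊓ t ∸ j ⊓ t)) r≡0)
                        (trans (cong (λ t → q + (0 ∸ t)) (⊓-zeroʳ j)) (+-identityʳ q)))
    qm≤n : q * m ≤ n
    qm≤n = subst (q * m ≤_) (sym (m≡m%n+[m/n]*n n m)) (m≤n+m (q * m) r)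
  ... | no r≢0 = ≤-trans (size-≤-suc j) (*-cancelʳ-< m q ℓ (<-≤-trans qm<n (≤-trans n≤mℓ (≤-reflexive (*-comm m ℓ)))))
    where
    qm<n : q * m < n
    qm<n = subst (q * m <_) (sym (m≡m%n+[m/n]*n n m)) (+-monoˡ-< (q * m) (n≢0⇒n>0 r≢0))

  earlier-block-below : ∀ {i i' u u'} → i < i' → u < size i → lower i + u < lower i' + u'
  earlier-block-below {i} {i'} {u} {u'} i<i' u<size = begin-strict
    lower i + u       <⟨ +-monoʳ-< (lower i) u<size ⟩
    lower i + size i  ≡⟨ lower-suc i ⟨
    lower (suc i)     ≤⟨ lower-mono i<i' ⟩
    lower i'          ≤⟨ m≤m+n (lower i') u' ⟩
    lower i' + u'     ∎
    where open ≤-Reasoning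

  lower+offset<n : ∀ {j t} → j < m → t < size j → lower j + t < n
  lower+offset<n {j} {t} j<m t<size =
    subst (lower j + t <_) (trans (+-identityʳ (lower m)) lower-m) (earlier-block-below {u' = 0} j<m t<size)

  locate : ∀ {k} → k < n → Σ ℕ λ j → j < m × Σ ℕ λ t → t < size j × lower j + t ≡ k
  locate {k} k<n = go m (subst (k <_) (sym lower-m) k<n)
    where
    go : ∀ m' → k < lower m' → Σ ℕ λ j → j < m' × Σ ℕ λ t → t < size j × lower j + t ≡ k
    go (suc m') k<lower with k <? lower m'
    ... | yes k<lower' = let j , j<m' , rest = go m' k<lower' in j , m<n⇒m<1+n j<m' , rest
    ... | no  k≮lower' = m' , n<1+n m' , k ∸ lower m' , +-cancelˡ-< (lower m') _ _ k<next , m+[n∸m]≡n lower≤k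
      where
      lower≤k : lower m' ≤ k
      lower≤k = ≮⇒≥ k≮lower'
      k<next : lower m' + (k ∸ lower m') < lower m' + size m'
      k<next = subst₂ _<_ (sym (m+[n∸m]≡n lower≤k)) (lower-suc m') k<lower

  locate-unique : ∀ {j j' t t'} → t < size j → t' < size j' → lower j + t ≡ lower j' + t' → j ≡ j' × t ≡ t'
  locate-unique {j} {j'} {t} {t'} t<size t'<size eq with <-cmp j j'
  ... | tri< j<j' _ _ = ⊥-elim (<-irrefl eq (earlier-block-below j<j' t<size))
  ... | tri> _ _ j'<j = ⊥-elim (<-irrefl (sym eq) (earlier-block-below j'<j t'<size))
  ... | tri≈ _ refl _ = refl , +-cancelˡ-≡ (lower j) t t' eq

-- The cosets of ⟨d⟩ are c + ⟨d⟩ for c < g = gcd N d, each of size n = N / g. In c + k d, c is recovered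
-- modulo g since g ∣ d, and k modulo n since N ∣ t d forces n ∣ t.
module Cosets (N : ℕ) .{{_ : NonZero N}} (d : ℕ) where

  g : ℕ
  g = gcd N d

  instance
    g-nonZero : NonZero g
    g-nonZero = ≢-nonZero (gcd[m,n]≢0 N d (inj₁ (≢-nonZero⁻¹ N)))

  n : ℕ
  n = N / g

  instance
    n-nonZero : NonZero n
    n-nonZero = ≢-nonZero (m/gcd[m,n]≢0 N d)

  g*n≡N : g * n ≡ N
  g*n≡N = m*[n/m]≡n (gcd[m,n]∣m N d)

  N∣t*d⇒n∣t : ∀ t → N ∣ t * d → n ∣ t
  N∣t*d⇒n∣t t N∣td = coprime-divisor (coprime-/gcd N d) (*-cancelˡ-∣ g (subst₂ _∣_ (sym g*n≡N) td≡g[et] N∣td))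
    where
    e = d / g
    td≡g[et] : t * d ≡ g * (e * t)
    td≡g[et] = trans (cong (t *_) (sym (m*[n/m]≡n (gcd[m,n]∣n N d)))) (lemma t g e)
      where
      lemma : ∀ t g e → t * (g * e) ≡ g * (e * t)
      lemma = solve-∀

  residue-injective : ∀ {c c' k k'} → c < g → c' < g →
                      (c + k * d) % N ≡ (c' + k' * d) % N → c ≡ c'
  residue-injective {c} {c'} {k} {k'} c<g c'<g eq = begin
    c                       ≡⟨ m<n⇒m%n≡m c<g ⟨
    c % g                   ≡⟨ %-remove-+ʳ c (∣n⇒∣m*n k g∣d) ⟨
    (c + k * d) % g         ≡⟨ m∣n⇒o%n%m≡o%m g N _ g∣N ⟨
    (c + k * d) % N % g     ≡⟨ cong (_% g) eq ⟩
    (c' + k' * d) % N % g   ≡⟨ m∣n⇒o%n%m≡o%m g N _ g∣N ⟩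
    (c' + k' * d) % g       ≡⟨ %-remove-+ʳ c' (∣n⇒∣m*n k' g∣d) ⟩
    c' % g                  ≡⟨ m<n⇒m%n≡m c'<g ⟩
    c'                      ∎
    where
    open ≡-Reasoning
    g∣d = gcd[m,n]∣n N d
    g∣N = gcd[m,n]∣m N d

  multiple-injective : ∀ {c k k'} → k < n → k' ≤ k → (c + k * d) % N ≡ (c + k' * d) % N → k ≡ k'
  multiple-injective {c} {k} {k'} k<n k'≤k eq = sym (≤-antisym k'≤k (m∸n≡0⇒m≤n k∸k'≡0))
    where
    N∣[k∸k']d : N ∣ (k ∸ k') * d
    N∣[k∸k']d = subst (N ∣_) (trans ([m+n]∸[m+o]≡n∸o c (k * d) (k' * d)) (sym (*-distribʳ-∸ d k k')))
                      (%-≡⇒∣∸ N eq)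
    k∸k'≡0 : k ∸ k' ≡ 0
    k∸k'≡0 = ∣∧<⇒≡0 (N∣t*d⇒n∣t (k ∸ k') N∣[k∸k']d) (≤-<-trans (m∸n≤m k k') k<n)

  coset-injective : ∀ {c c' k k'} → c < g → c' < g → k < n → k' < n →
                    (c + k * d) % N ≡ (c' + k' * d) % N → c ≡ c' × k ≡ k'
  coset-injective {k = k} {k'} c<g c'<g k<n k'<n eq with residue-injective {k = k} {k'} c<g c'<g eq
  ... | refl with ≤-total k' k
  ...   | inj₁ k'≤k = refl , multiple-injective k<n k'≤k eq
  ...   | inj₂ k≤k' = refl , sym (multiple-injective k'<n k≤k' (sym eq))

  coset-surjective : ∀ (x : Fin N) → Σ (Fin g) λ c → Σ (Fin n) λ k → (toℕ c + toℕ k * d) % N ≡ toℕ x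
  coset-surjective x = c , k , trans (sym (toℕ-fromℕ< _)) (cong toℕ (proj₂ (onto x) refl))
    where
    point : Fin (g * n) → Fin N
    point p = (toℕ (proj₁ (remQuot {g} n p)) + toℕ (proj₂ (remQuot {g} n p)) * d) mod N
    point-injective : Injective _≡_ _≡_ point
    point-injective {p} {p'} eq
      with coset-injective (toℕ<n (proj₁ (remQuot {g} n p))) (toℕ<n (proj₁ (remQuot {g} n p')))
                           (toℕ<n (proj₂ (remQuot {g} n p))) (toℕ<n (proj₂ (remQuot {g} n p')))
                           (trans (sym (toℕ-fromℕ< _)) (trans (cong toℕ eq) (toℕ-fromℕ< _)))
    ... | c≡c' , k≡k' = trans (sym (combine-remQuot {g} n p))
                              (trans (cong₂ combine (toℕ-injective c≡c') (toℕ-injective k≡k')) (combine-remQuot {g} n p'))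
    onto : Surjective _≡_ _≡_ point
    onto = injective⇒surjective (≤-reflexive (sym g*n≡N)) point-injective
    c = proj₁ (remQuot {g} n (proj₁ (onto x)))
    k = proj₂ (remQuot {g} n (proj₁ (onto x)))

-- Part i = (c , j) is the j-th block of the coset c + ⟨d⟩, traversed as c, c + d, c + 2d, …
module CosetBlocks (N : ℕ) .{{_ : NonZero N}} (δ : Fin N) (m : ℕ) .{{_ : NonZero m}} where
  open Cosets N (toℕ δ)

  private
    d : ℕ
    d = toℕ δ
  open Blocks n m

  M : ℕ
  M = g * m

  coset : Fin M → Fin g
  coset i = proj₁ (remQuot {g} m i)

  block : Fin M → Fin m
  block i = proj₂ (remQuot {g} m i)

  a : Fin M → Fin N
  a i = (toℕ (coset i) + lower (toℕ (block i)) * d) mod N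

  L : Fin M → ℕ
  L i = size (toℕ (block i))

  toℕ-apTerm : ∀ i t → toℕ (apTerm N (a i) δ t) ≡ (toℕ (coset i) + (lower (toℕ (block i)) + t) * d) % N
  toℕ-apTerm i t = begin
    toℕ ((toℕ (a i) + t * d) mod N)   ≡⟨ toℕ-fromℕ< _ ⟩
    (toℕ (a i) + t * d) % N           ≡⟨ cong (λ u → (u + t * d) % N) (toℕ-fromℕ< _) ⟩
    ((c + s * d) % N + t * d) % N     ≡⟨ %-absorbˡ-+ N _ _ ⟩
    (c + s * d + t * d) % N           ≡⟨ cong (_% N) (lemma c s t d) ⟩
    (c + (s + t) * d) % N             ∎
    where
    open ≡-Reasoning
    c = toℕ (coset i)
    s = lower (toℕ (block i))
    lemma : ∀ c s t d → c + s * d + t * d ≡ c + (s + t) * d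
    lemma = solve-∀

  index-injective : ∀ {i i'} → coset i ≡ coset i' → block i ≡ block i' → i ≡ i'
  index-injective {i} {i'} c≡c' j≡j' =
    trans (sym (combine-remQuot {g} m i)) (trans (cong₂ combine c≡c' j≡j') (combine-remQuot {g} m i'))

  apTerm-injective : ∀ {i i' t t'} → t < L i → t' < L i' →
                     apTerm N (a i) δ t ≡ apTerm N (a i') δ t' → i ≡ i' × t ≡ t'
  apTerm-injective {i} {i'} {t} {t'} t<L t'<L eq
    with coset-injective (toℕ<n (coset i)) (toℕ<n (coset i'))
                         (lower+offset<n (toℕ<n (block i)) t<L) (lower+offset<n (toℕ<n (block i')) t'<L)
                         (trans (sym (toℕ-apTerm i t)) (trans (cong toℕ eq) (toℕ-apTerm i' t')))
  ... | c≡c' , k≡k' with locate-unique t<L t'<L k≡k'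
  ...   | j≡j' , t≡t' = index-injective (toℕ-injective c≡c') (toℕ-injective j≡j') , t≡t'

  apTerm-surjective : ∀ (x : Fin N) → Σ (Fin M) λ i → Σ ℕ λ t → t < L i × apTerm N (a i) δ t ≡ x
  apTerm-surjective x = i , t , subst (λ u → t < size u) (sym block≡j) t<size , toℕ-injective (begin
    toℕ (apTerm N (a i) δ t)                                ≡⟨ toℕ-apTerm i t ⟩
    (toℕ (coset i) + (lower (toℕ (block i)) + t) * d) % N  ≡⟨ cong₂ (λ u v → (toℕ u + (lower v + t) * d) % N) coset≡c block≡j ⟩
    (toℕ c + (lower j + t) * d) % N                         ≡⟨ cong (λ u → (toℕ c + u * d) % N) jt≡k ⟩
    (toℕ c + toℕ k * d) % N                                 ≡⟨ ck≡x ⟩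
    toℕ x                                                   ∎)
    where
    open ≡-Reasoning
    c : Fin g
    c = proj₁ (coset-surjective x)
    k : Fin n
    k = proj₁ (proj₂ (coset-surjective x))
    ck≡x : (toℕ c + toℕ k * d) % N ≡ toℕ x
    ck≡x = proj₂ (proj₂ (coset-surjective x))
    located = locate (toℕ<n k)
    j = proj₁ located
    j<m = proj₁ (proj₂ located)
    t = proj₁ (proj₂ (proj₂ located))
    t<size = proj₁ (proj₂ (proj₂ (proj₂ located)))
    jt≡k = proj₂ (proj₂ (proj₂ (proj₂ located)))
    i = combine c (fromℕ< j<m)
    coset≡c : coset i ≡ c
    coset≡c = cong proj₁ (remQuot-combine c (fromℕ< j<m))
    block≡j : toℕ (block i) ≡ j
    block≡j = trans (cong (toℕ ∘ proj₂) (remQuot-combine c (fromℕ< j<m))) (toℕ-fromℕ< j<m)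

  isAPPartition : m ≤ n → IsAPPartition N M δ a L
  isAPPartition m≤n = (λ i → size-≥1 m≤n (toℕ (block i))) , cover
    where
    cover : (x : Fin N) → Σ (Fin M) λ i → Σ ℕ λ t → t < L i × apTerm N (a i) δ t ≡ x ×
            ((i' : Fin M) (t' : ℕ) → t' < L i' → apTerm N (a i') δ t' ≡ x → i' ≡ i × t' ≡ t)
    cover x = let i , t , t<L , eq = apTerm-surjective x in
      i , t , t<L , eq , λ i' t' t'<L eq' → apTerm-injective t'<L t<L (trans eq' (sym eq))

module _ (N : ℕ) .{{_ : NonZero N}} where

  toℕ-apTerm-≡[mod] : ∀ a d k → + toℕ (apTerm N a d k) ≡ + toℕ a ℤ.+ + k ℤ.* + toℕ d [mod N ]
  toℕ-apTerm-≡[mod] a d k = mod-trans (toℕ-mod-≡[mod] N _)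
    (≡⇒≡[mod] (trans (ℤₚ.pos-+ (toℕ a) _) (cong (ℤ._+_ (+ toℕ a)) (ℤₚ.pos-* k (toℕ d)))))

  toℕ-phi-≡[mod] : ∀ r₁ r₂ x y → + toℕ (phi N r₁ r₂ x y) ≡ + toℕ r₁ ℤ.* + toℕ x ℤ.+ + toℕ r₂ ℤ.* + toℕ y [mod N ]
  toℕ-phi-≡[mod] r₁ r₂ x y = mod-trans (toℕ-mod-≡[mod] N _)
    (≡⇒≡[mod] (trans (ℤₚ.pos-+ (toℕ r₁ * toℕ x) _) (cong₂ ℤ._+_ (ℤₚ.pos-* (toℕ r₁) _) (ℤₚ.pos-* (toℕ r₂) _))))

  module _ (r₁ r₂ d : Fin N) {D₁ D₂ : ℤ}
           (r₁d≡D₁ : + toℕ r₁ ℤ.* + toℕ d ≡ D₁ [mod N ]) (r₂d≡D₂ : + toℕ r₂ ℤ.* + toℕ d ≡ D₂ [mod N ]) where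

    phi-apTerm-difference : ∀ a b k k' l l' →
      + toℕ (phi N r₁ r₂ (apTerm N a d k) (apTerm N b d l)) ℤ.- + toℕ (phi N r₁ r₂ (apTerm N a d k') (apTerm N b d l'))
        ≡ (+ k ℤ.- + k') ℤ.* D₁ ℤ.+ (+ l ℤ.- + l') ℤ.* D₂ [mod N ]
    phi-apTerm-difference a b k k' l l' =
      mod-trans (mod-- (value k l) (value k' l'))
        (mod-trans (≡⇒≡[mod] (lemma (+ toℕ r₁) (+ toℕ r₂) (+ toℕ a) (+ toℕ b) (+ k) (+ k') (+ l) (+ l') (+ toℕ d)))
                   (mod-+ (mod-*ˡ (+ k ℤ.- + k') r₁d≡D₁) (mod-*ˡ (+ l ℤ.- + l') r₂d≡D₂)))
      where
      value : ∀ k l → + toℕ (phi N r₁ r₂ (apTerm N a d k) (apTerm N b d l))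
                        ≡ + toℕ r₁ ℤ.* (+ toℕ a ℤ.+ + k ℤ.* + toℕ d) ℤ.+ + toℕ r₂ ℤ.* (+ toℕ b ℤ.+ + l ℤ.* + toℕ d) [mod N ]
      value k l = mod-trans (toℕ-phi-≡[mod] r₁ r₂ _ _)
        (mod-+ (mod-*ˡ (+ toℕ r₁) (toℕ-apTerm-≡[mod] a d k)) (mod-*ˡ (+ toℕ r₂) (toℕ-apTerm-≡[mod] b d l)))
      lemma : ∀ r₁ r₂ a b k k' l l' d →
        (r₁ ℤ.* (a ℤ.+ k ℤ.* d) ℤ.+ r₂ ℤ.* (b ℤ.+ l ℤ.* d)) ℤ.- (r₁ ℤ.* (a ℤ.+ k' ℤ.* d) ℤ.+ r₂ ℤ.* (b ℤ.+ l' ℤ.* d))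
          ≡ (k ℤ.- k') ℤ.* (r₁ ℤ.* d) ℤ.+ (l ℤ.- l') ℤ.* (r₂ ℤ.* d)
      lemma = ℤ-solve-∀

    diam-phi-apTerm-≤ : ∀ a b {ℓ k k' l l'} → k ≤ ℓ → k' ≤ ℓ → l ≤ ℓ → l' ≤ ℓ →
      distN N (phi N r₁ r₂ (apTerm N a d k) (apTerm N b d l)) (phi N r₁ r₂ (apTerm N a d k') (apTerm N b d l'))
        ≤ ℓ * (∣ D₁ ∣ + ∣ D₂ ∣)
    diam-phi-apTerm-≤ a b {ℓ} {k} {k'} {l} {l'} k≤ℓ k'≤ℓ l≤ℓ l'≤ℓ =
      ≤-trans (distN-≤ N (phi N r₁ r₂ (apTerm N a d k) (apTerm N b d l)) (phi N r₁ r₂ (apTerm N a d k') (apTerm N b d l'))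
                       _ (phi-apTerm-difference a b k k' l l')) (begin
        ∣ (+ k ℤ.- + k') ℤ.* D₁ ℤ.+ (+ l ℤ.- + l') ℤ.* D₂ ∣      ≤⟨ ℤₚ.∣i+j∣≤∣i∣+∣j∣ ((+ k ℤ.- + k') ℤ.* D₁) ((+ l ℤ.- + l') ℤ.* D₂) ⟩
        ∣ (+ k ℤ.- + k') ℤ.* D₁ ∣ + ∣ (+ l ℤ.- + l') ℤ.* D₂ ∣    ≡⟨ cong₂ _+_ (ℤₚ.∣i*j∣≡∣i∣*∣j∣ (+ k ℤ.- + k') D₁) (ℤₚ.∣i*j∣≡∣i∣*∣j∣ (+ l ℤ.- + l') D₂) ⟩
        ∣ + k ℤ.- + k' ∣ * ∣ D₁ ∣ + ∣ + l ℤ.- + l' ∣ * ∣ D₂ ∣    ≤⟨ +-mono-≤ (*-monoˡ-≤ ∣ D₁ ∣ (∣k-k'∣≤ℓ k≤ℓ k'≤ℓ))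
                                                                            (*-monoˡ-≤ ∣ D₂ ∣ (∣k-k'∣≤ℓ l≤ℓ l'≤ℓ)) ⟩
        ℓ * ∣ D₁ ∣ + ℓ * ∣ D₂ ∣                                  ≡⟨ *-distribˡ-+ ℓ ∣ D₁ ∣ ∣ D₂ ∣ ⟨
        ℓ * (∣ D₁ ∣ + ∣ D₂ ∣)                                    ∎)
      where open ≤-Reasoning

SmallDiameterPartition : (N : ℕ) .{{_ : NonZero N}} → Fin N → Fin N → ℕ → ℕ → Set
SmallDiameterPartition N r₁ r₂ s M =
  Σ (Fin N) λ d → Σ (Fin M → Fin N) λ a → Σ (Fin M → ℕ) λ L →
    IsAPPartition N M d a L × ((i j : Fin M) → L i ≤ L j + 1) × ((i j : Fin M) → DiamPhiLe N M r₁ r₂ d a L i j s)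

-- Each coset of ⟨d⟩ is cut into ⌈n / (ℓ + 1)⌉ blocks, so every block has at most ℓ + 1 terms.
small-diameter-partition : ∀ N .{{_ : NonZero N}} (r₁ r₂ d : Fin N) {D₁ D₂ : ℤ} →
  + toℕ r₁ ℤ.* + toℕ d ≡ D₁ [mod N ] → + toℕ r₂ ℤ.* + toℕ d ≡ D₂ [mod N ] →
  ∀ {s} ℓ → ℓ * (∣ D₁ ∣ + ∣ D₂ ∣) ≤ s →
  Σ ℕ λ M → M * suc ℓ ≤ N + gcd N (toℕ d) * suc ℓ × SmallDiameterPartition N r₁ r₂ s M
small-diameter-partition N r₁ r₂ d r₁d≡D₁ r₂d≡D₂ {s} ℓ ℓD≤s =
  M , M-bound , d , a , L , isAPPartition m≤n , (λ i j → size-balanced (toℕ (block i)) (toℕ (block j))) , diam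
  where
  open Cosets N (toℕ d)
  m : ℕ
  m = (n + ℓ) / suc ℓ
  instance
    m-nonZero : NonZero m
    m-nonZero = >-nonZero (m≥n⇒m/n>0 {n + ℓ} {suc ℓ} (+-monoˡ-≤ ℓ (>-nonZero⁻¹ n)))
  m≤n : m ≤ n
  m≤n = [n+ℓ]/[1+ℓ]≤n n ℓ
  open Blocks n m
  open CosetBlocks N d m

  M-bound : g * m * suc ℓ ≤ N + g * suc ℓ
  M-bound = begin
    g * m * suc ℓ      ≡⟨ *-assoc g m (suc ℓ) ⟩
    g * (m * suc ℓ)    ≤⟨ *-monoʳ-≤ g (m/n*n≤m (n + ℓ) (suc ℓ)) ⟩
    g * (n + ℓ)        ≡⟨ *-distribˡ-+ g n ℓ ⟩
    g * n + g * ℓ      ≤⟨ +-mono-≤ (≤-reflexive g*n≡N) (*-monoʳ-≤ g (n≤1+n ℓ)) ⟩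
    N + g * suc ℓ      ∎
    where open ≤-Reasoning

  offset-≤ℓ : ∀ i {k} → k < L i → k ≤ ℓ
  offset-≤ℓ i k<L = s≤s⁻¹ (<-≤-trans k<L (size-≤ (n≤[n+ℓ]/[1+ℓ]*[1+ℓ] n ℓ) (toℕ (block i))))

  diam : (i j : Fin M) → DiamPhiLe N M r₁ r₂ d a L i j s
  diam i j k k' l l' k<L k'<L l<L l'<L = ≤-trans
    (diam-phi-apTerm-≤ N r₁ r₂ d r₁d≡D₁ r₂d≡D₂ (a i) (a j) (offset-≤ℓ i k<L) (offset-≤ℓ i k'<L) (offset-≤ℓ j l<L) (offset-≤ℓ j l'<L))
    ℓD≤s

same-box⇒∣x-y∣≤C : ∀ {C x y} → x / suc C ≡ y / suc C → ∣ + x ℤ.- + y ∣ ≤ C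
same-box⇒∣x-y∣≤C {C} {x} {y} x/B≡y/B =
  subst (λ z → ∣ z ∣ ≤ C) (sym x-y≡) (∣k-k'∣≤ℓ (s≤s⁻¹ (m%n<n x (suc C))) (s≤s⁻¹ (m%n<n y (suc C))))
  where
  B = suc C
  split : ∀ z → + z ≡ + (z % B) ℤ.+ + (z / B * B)
  split z = trans (cong +_ (m≡m%n+[m/n]*n z B)) (ℤₚ.pos-+ (z % B) _)
  x-y≡ : + x ℤ.- + y ≡ + (x % B) ℤ.- + (y % B)
  x-y≡ = trans (cong₂ ℤ._-_ (split x) (trans (split y) (cong (λ q → + (y % B) ℤ.+ + (q * B)) (sym x/B≡y/B))))
               (lemma (+ (x % B)) (+ (y % B)) (+ (x / B * B)))
    where
    lemma : ∀ a b c → (a ℤ.+ c) ℤ.- (b ℤ.+ c) ≡ a ℤ.- b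
    lemma = ℤ-solve-∀

multiple-difference : ∀ N .{{_ : NonZero N}} R {i j} → i ≤ j →
                      + R ℤ.* + (j ∸ i) ≡ + (R * j % N) ℤ.- + (R * i % N) [mod N ]
multiple-difference N R {i} {j} i≤j = mod-trans (≡⇒≡[mod] exact) (mod-- (mod-sym (%-≡[mod] N _)) (mod-sym (%-≡[mod] N _)))
  where
  exact : + R ℤ.* + (j ∸ i) ≡ + (R * j) ℤ.- + (R * i)
  exact = begin
    + R ℤ.* + (j ∸ i)          ≡⟨ ℤₚ.pos-* R (j ∸ i) ⟨
    + (R * (j ∸ i))            ≡⟨ cong +_ (*-distribˡ-∸ R j i) ⟩
    + (R * j ∸ R * i)          ≡⟨ ℤₚ.⊖-≥ (*-monoʳ-≤ R i≤j) ⟨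
    R * j ⊖ R * i            ≡⟨ ℤₚ.m-n≡m⊖n (R * j) (R * i) ⟨
    + (R * j) ℤ.- + (R * i)    ∎
    where open ≡-Reasoning

record SmallStep (N : ℕ) (r₁ r₂ : Fin N) (C b : ℕ) : Set where
  field
    step       : Fin N
    gcd-≤      : gcd N (toℕ step) ≤ b * b
    D₁ D₂      : ℤ
    r₁·step≡D₁ : + toℕ r₁ ℤ.* + toℕ step ≡ D₁ [mod N ]
    r₂·step≡D₂ : + toℕ r₂ ℤ.* + toℕ step ≡ D₂ [mod N ]
    ∣D₁∣≤C     : ∣ D₁ ∣ ≤ C
    ∣D₂∣≤C     : ∣ D₂ ∣ ≤ C

small-step : ∀ N .{{_ : NonZero N}} (r₁ r₂ : Fin N) {C b} → N ≤ b * suc C → SmallStep N r₁ r₂ C b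
small-step N@(suc _) r₁ r₂ {C} {b} N≤bB with b * b <? N
... | no b²≮N = record
  { step = Fin.zero ; gcd-≤ = subst (_≤ b * b) (sym (gcd-identityʳ N)) (≮⇒≥ b²≮N)
  ; D₁ = + 0 ; D₂ = + 0
  ; r₁·step≡D₁ = ≡⇒≡[mod] (ℤₚ.*-zeroʳ (+ toℕ r₁)) ; r₂·step≡D₂ = ≡⇒≡[mod] (ℤₚ.*-zeroʳ (+ toℕ r₂))
  ; ∣D₁∣≤C = z≤n ; ∣D₂∣≤C = z≤n }
... | yes b²<N = record
  { step = fromℕ< d<N ; gcd-≤ = ≤-trans (gcd[m,n]≤n N (toℕ (fromℕ< d<N)) {{d-nonZero}}) d≤b²
  ; D₁ = representative R₁ ; D₂ = representative R₂
  ; r₁·step≡D₁ = congruence R₁ ; r₂·step≡D₂ = congruence R₂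
  ; ∣D₁∣≤C = close R₁ (proj₁ same-boxes) ; ∣D₂∣≤C = close R₂ (proj₂ same-boxes) }
  where
  R₁ = toℕ r₁
  R₂ = toℕ r₂
  box : ℕ → Fin b
  box x = fromℕ< (m<n*o⇒m/o<n {x % N} {b} {suc C} (<-≤-trans (m%n<n x N) N≤bB))
  signature : Fin (suc (b * b)) → Fin (b * b)
  signature k = combine (box (R₁ * toℕ k)) (box (R₂ * toℕ k))
  collision = pigeonhole (n<1+n (b * b)) signature
  i = toℕ (proj₁ collision)
  j = toℕ (proj₁ (proj₂ collision))
  i<j : i < j
  i<j = proj₁ (proj₂ (proj₂ collision))
  same-boxes = combine-injective _ _ _ _ (proj₂ (proj₂ (proj₂ collision)))
  d<N : j ∸ i < N
  d<N = ≤-<-trans (≤-trans (m∸n≤m j i) (s≤s⁻¹ (toℕ<n (proj₁ (proj₂ collision))))) b²<N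
  d≤b² : toℕ (fromℕ< d<N) ≤ b * b
  d≤b² = ≤-trans (≤-reflexive (toℕ-fromℕ< _)) (≤-trans (m∸n≤m j i) (s≤s⁻¹ (toℕ<n (proj₁ (proj₂ collision)))))
  d-nonZero : NonZero (toℕ (fromℕ< d<N))
  d-nonZero = >-nonZero (subst (0 <_) (sym (toℕ-fromℕ< d<N)) (m<n⇒0<n∸m i<j))
  representative : ℕ → ℤ
  representative R = + (R * j % N) ℤ.- + (R * i % N)
  congruence : ∀ R → + R ℤ.* + toℕ (fromℕ< d<N) ≡ representative R [mod N ]
  congruence R rewrite toℕ-fromℕ< d<N = multiple-difference N R (<⇒≤ i<j)
  close : ∀ R → box (R * i) ≡ box (R * j) → ∣ representative R ∣ ≤ C
  close R eq = same-box⇒∣x-y∣≤C {C} {R * j % N} {R * i % N} (sym (trans (sym (toℕ-fromℕ< _)) (trans (cong toℕ eq) (toℕ-fromℕ< _))))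

cube-+-≤-ordered : ∀ x e → (x + (x + e)) ^ 3 ≤ 4 * (x ^ 3 + (x + e) ^ 3)
cube-+-≤-ordered x e = subst ((x + (x + e)) ^ 3 ≤_) (sym (lemma x e)) (m≤m+n _ (6 * x * e * e + 3 * e * e * e))
  where
  lemma : ∀ x e → 4 * (x * (x * (x * 1)) + (x + e) * ((x + e) * ((x + e) * 1)))
                  ≡ (x + (x + e)) * ((x + (x + e)) * ((x + (x + e)) * 1)) + (6 * x * e * e + 3 * e * e * e)
  lemma = solve-∀

cube-+-≤ : ∀ x y → (x + y) ^ 3 ≤ 4 * (x ^ 3 + y ^ 3)
cube-+-≤ x y with ≤-total x y
... | inj₁ x≤y = subst (λ z → (x + z) ^ 3 ≤ 4 * (x ^ 3 + z ^ 3)) (m+[n∸m]≡n x≤y) (cube-+-≤-ordered x (y ∸ x))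
... | inj₂ y≤x = subst (λ z → (z + y) ^ 3 ≤ 4 * (z ^ 3 + y ^ 3)) (m+[n∸m]≡n y≤x)
                   (subst₂ _≤_ (cong (_^ 3) (+-comm y _)) (cong (4 *_) (+-comm (y ^ 3) _)) (cube-+-≤-ordered y (x ∸ y)))

cube-root : ∀ {T} → 1 ≤ T → Σ ℕ λ C → C ^ 3 < T × T ≤ suc C ^ 3
cube-root {suc T} _ = go T
  where
  go : ∀ T → Σ ℕ λ C → C ^ 3 < suc T × suc T ≤ suc C ^ 3
  go zero    = 0 , s≤s z≤n , s≤s z≤n
  go (suc T) with go T
  ... | C , C³≤T , T<[1+C]³ with suc (suc T) ≤? suc C ^ 3
  ...   | yes fits = C , m<n⇒m<1+n C³≤T , fits
  ...   | no ¬fits = suc C , ≰⇒> ¬fits , ≤-trans (s≤s T<[1+C]³) (^-monoˡ-< 3 (n<1+n (suc C)))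

C³<T⇒[1+C]³≤8T : ∀ {C T} → C ^ 3 < T → suc C ^ 3 ≤ 8 * T
C³<T⇒[1+C]³≤8T {zero}  {T} 0<T = ≤-trans 0<T (m≤n*m T 8)
C³<T⇒[1+C]³≤8T {suc C} {T} C³<T = begin
  suc (suc C) ^ 3         ≤⟨ ^-monoˡ-≤ 3 (s≤s (m≤n+m (suc C) C)) ⟩
  (suc C + suc C) ^ 3     ≡⟨ lemma (suc C) ⟩
  8 * suc C ^ 3           ≤⟨ *-monoʳ-≤ 8 (<⇒≤ C³<T) ⟩
  8 * T                   ∎
  where
  open ≤-Reasoning
  lemma : ∀ x → (x + x) * ((x + x) * ((x + x) * 1)) ≡ 8 * (x * (x * (x * 1)))
  lemma = solve-∀

^3-cancel-< : ∀ {x y} → x ^ 3 < y ^ 3 → x < y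
^3-cancel-< {x} {y} x³<y³ = ≰⇒> λ y≤x → <⇒≱ x³<y³ (^-monoˡ-≤ 3 y≤x)

C³<Ns⇒C<N : ∀ {C N s} .{{_ : NonZero N}} → C ^ 3 < N * s → s ≤ N → C < N
C³<Ns⇒C<N {C} {N} {s} C³<Ns s≤N = ^3-cancel-< (<-≤-trans C³<Ns (*-monoʳ-≤ N (≤-trans s≤N N≤N²)))
  where
  N≤N² : N ≤ N * (N * 1)
  N≤N² = subst (N ≤_) (cong (N *_) (sym (*-identityʳ N))) (m≤m*n N N)

length-term-bound : ∀ {P s B N} .{{_ : NonZero s}} → P * s ≤ (B + B) * N → B ^ 3 ≤ 8 * (N * s) →
                    P ^ 3 * s ^ 2 ≤ 64 * N ^ 4
length-term-bound {P} {s} {B} {N} Ps≤2BN B³≤8Ns = *-cancelʳ-≤ _ _ s (begin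
  P ^ 3 * s ^ 2 * s        ≡⟨ lemma₁ P s ⟩
  (P * s) ^ 3              ≤⟨ ^-monoˡ-≤ 3 Ps≤2BN ⟩
  ((B + B) * N) ^ 3        ≡⟨ lemma₂ B N ⟩
  8 * (B ^ 3 * N ^ 3)      ≤⟨ *-monoʳ-≤ 8 (*-monoˡ-≤ (N ^ 3) B³≤8Ns) ⟩
  8 * (8 * (N * s) * N ^ 3) ≡⟨ lemma₃ N s ⟩
  64 * N ^ 4 * s           ∎)
  where
  open ≤-Reasoning
  lemma₁ : ∀ x y → x * (x * (x * 1)) * (y * (y * 1)) * y ≡ (x * y) * ((x * y) * ((x * y) * 1))
  lemma₁ = solve-∀
  lemma₂ : ∀ x y → ((x + x) * y) * (((x + x) * y) * (((x + x) * y) * 1)) ≡ 8 * (x * (x * (x * 1)) * (y * (y * (y * 1))))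
  lemma₂ = solve-∀
  lemma₃ : ∀ x y → 8 * (8 * (x * y) * (x * (x * (x * 1)))) ≡ 64 * (x * (x * (x * (x * 1)))) * y
  lemma₃ = solve-∀

gcd-term-bound : ∀ {g b B N s} .{{_ : NonZero N}} → g ≤ b * b → b * B ≤ N + N → N * s ≤ B ^ 3 →
                 g ^ 3 * s ^ 2 ≤ 64 * N ^ 4
gcd-term-bound {g} {b} {B} {N} {s} g≤b² bB≤2N Ns≤B³ = *-cancelʳ-≤ _ _ (N ^ 2) {{m^n≢0 N 2}} (begin
  g ^ 3 * s ^ 2 * N ^ 2          ≡⟨ lemma₁ g s N ⟩
  g ^ 3 * (N * s) ^ 2            ≤⟨ *-monoʳ-≤ (g ^ 3) (^-monoˡ-≤ 2 Ns≤B³) ⟩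
  g ^ 3 * (B ^ 3) ^ 2            ≡⟨ lemma₂ g B ⟩
  (g * (B * B)) ^ 3              ≤⟨ ^-monoˡ-≤ 3 (*-monoˡ-≤ (B * B) g≤b²) ⟩
  (b * b * (B * B)) ^ 3          ≡⟨ cong (_^ 3) (lemma₃ b B) ⟩
  ((b * B) * (b * B)) ^ 3        ≤⟨ ^-monoˡ-≤ 3 (*-mono-≤ bB≤2N bB≤2N) ⟩
  ((N + N) * (N + N)) ^ 3        ≡⟨ lemma₄ N ⟩
  64 * N ^ 4 * N ^ 2             ∎)
  where
  open ≤-Reasoning
  lemma₁ : ∀ x y z → x * (x * (x * 1)) * (y * (y * 1)) * (z * (z * 1)) ≡ x * (x * (x * 1)) * ((z * y) * ((z * y) * 1))
  lemma₁ = solve-∀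
  lemma₂ : ∀ x y → x * (x * (x * 1)) * ((y * (y * (y * 1))) * ((y * (y * (y * 1))) * 1))
                   ≡ (x * (y * y)) * ((x * (y * y)) * ((x * (y * y)) * 1))
  lemma₂ = solve-∀
  lemma₃ : ∀ x y → x * x * (y * y) ≡ (x * y) * (x * y)
  lemma₃ = solve-∀
  lemma₄ : ∀ x → ((x + x) * (x + x)) * (((x + x) * (x + x)) * (((x + x) * (x + x)) * 1))
                 ≡ 64 * (x * (x * (x * (x * 1)))) * (x * (x * 1))
  lemma₄ = solve-∀

partition-count-bound : ∀ {M ℓ g b B N s} .{{_ : NonZero N}} .{{_ : NonZero s}} →
  M * ℓ ≤ N + g * ℓ → s ≤ (B + B) * ℓ → g ≤ b * b → b * B ≤ N + N → N * s ≤ B ^ 3 → B ^ 3 ≤ 8 * (N * s) →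
  M ^ 3 * s ^ 2 ≤ 512 * N ^ 4
partition-count-bound {M} {ℓ} {g} {b} {B} {N} {s} Mℓ≤N+gℓ s≤2Bℓ g≤b² bB≤2N Ns≤B³ B³≤8Ns = begin
  M ^ 3 * s ^ 2                              ≤⟨ *-monoˡ-≤ (s ^ 2) (^-monoˡ-≤ 3 (m≤n+m∸n M g)) ⟩
  (g + P) ^ 3 * s ^ 2                        ≤⟨ *-monoˡ-≤ (s ^ 2) (cube-+-≤ g P) ⟩
  4 * (g ^ 3 + P ^ 3) * s ^ 2                ≡⟨ lemma₁ (g ^ 3) (P ^ 3) (s ^ 2) ⟩
  4 * (g ^ 3 * s ^ 2 + P ^ 3 * s ^ 2)        ≤⟨ *-monoʳ-≤ 4 (+-mono-≤ (gcd-term-bound {g} {b} {B} {N} {s} g≤b² bB≤2N Ns≤B³)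
                                                                      (length-term-bound {P} {s} {B} {N} Ps≤2BN B³≤8Ns)) ⟩
  4 * (64 * N ^ 4 + 64 * N ^ 4)              ≡⟨ lemma₂ (N ^ 4) ⟩
  512 * N ^ 4                                ∎
  where
  open ≤-Reasoning
  P = M ∸ g
  Pℓ≤N : P * ℓ ≤ N
  Pℓ≤N = subst (_≤ N) (sym (*-distribʳ-∸ ℓ M g)) (m≤n+o⇒m∸n≤o (M * ℓ) (g * ℓ) (subst (M * ℓ ≤_) (+-comm N (g * ℓ)) Mℓ≤N+gℓ))
  lemma₃ : ∀ x y z → x * (y * z) ≡ y * (x * z)
  lemma₃ = solve-∀
  Ps≤2BN : P * s ≤ (B + B) * N
  Ps≤2BN = begin
    P * s                ≤⟨ *-monoʳ-≤ P s≤2Bℓ ⟩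
    P * ((B + B) * ℓ)    ≡⟨ lemma₃ P (B + B) ℓ ⟩
    (B + B) * (P * ℓ)    ≤⟨ *-monoʳ-≤ (B + B) Pℓ≤N ⟩
    (B + B) * N          ∎
  lemma₁ : ∀ x y z → 4 * (x + y) * z ≡ 4 * (x * z + y * z)
  lemma₁ = solve-∀
  lemma₂ : ∀ x → 4 * (64 * x + 64 * x) ≡ 512 * x
  lemma₂ = solve-∀

lemma5p3 : (s N : ℕ) .{{_ : NonZero N}} → 1 ≤ s → s ≤ N →
    (r₁ r₂ : Fin N) → ¬ (toℕ r₁ ≡ 0 × toℕ r₂ ≡ 0) →
    Σ ℕ λ M → Σ (Fin N) λ d → Σ (Fin M → Fin N) λ a → Σ (Fin M → ℕ) λ L →
      IsAPPartition N M d a L ×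
      (M ^ 3 * s ^ 2 ≤ 512 * N ^ 4) ×
      ((i j : Fin M) → L i ≤ L j + 1) ×
      ((i j : Fin M) → DiamPhiLe N M r₁ r₂ d a L i j s)
lemma5p3 s N 1≤s s≤N r₁ r₂ _ =
  let M , M-bound , d , a , L , partition , balanced , diam =
        small-diameter-partition N r₁ r₂ step r₁·step≡D₁ r₂·step≡D₂ ℓ ℓ[∣D₁∣+∣D₂∣]≤s
  in M , d , a , L , partition , count-bound M M-bound , balanced , diam
  where
  instance
    s-nonZero : NonZero s
    s-nonZero = >-nonZero 1≤s
  root = cube-root (*-mono-≤ (>-nonZero⁻¹ N) 1≤s)
  C = proj₁ root
  B = suc C
  C³<Ns : C ^ 3 < N * s
  C³<Ns = proj₁ (proj₂ root)
  Ns≤B³ : N * s ≤ B ^ 3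
  Ns≤B³ = proj₂ (proj₂ root)
  b = (N + C) / B
  bB≤2N : b * B ≤ N + N
  bB≤2N = ≤-trans (m/n*n≤m (N + C) B) (+-monoʳ-≤ N (<⇒≤ (C³<Ns⇒C<N {C} C³<Ns s≤N)))
  open SmallStep (small-step N r₁ r₂ {C} {b} (n≤[n+ℓ]/[1+ℓ]*[1+ℓ] N C))
  ℓ = s / (B + B)
  ℓ[∣D₁∣+∣D₂∣]≤s : ℓ * (∣ D₁ ∣ + ∣ D₂ ∣) ≤ s
  ℓ[∣D₁∣+∣D₂∣]≤s = ≤-trans (*-monoʳ-≤ ℓ (+-mono-≤ (m≤n⇒m≤1+n ∣D₁∣≤C) (m≤n⇒m≤1+n ∣D₂∣≤C))) (m/n*n≤m s (B + B))
  count-bound : ∀ M → M * suc ℓ ≤ N + gcd N (toℕ step) * suc ℓ → M ^ 3 * s ^ 2 ≤ 512 * N ^ 4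
  count-bound M M-bound = partition-count-bound {M} {suc ℓ} {gcd N (toℕ step)} {b} {B} {N} {s}
    M-bound (m≤n*[1+m/n] s (B + B)) gcd-≤ bB≤2N Ns≤B³ (C³<T⇒[1+C]³≤8T {C} C³<Ns)
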